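{- Let $X$ be a set of variables, let $C,L\subseteq\mathbb{Q}[X]$ with $C$ a cone, and let $L'\subseteq\mathrm{units}(C)+L$. Then $\mathrm{cp}_{L'}(C)\subseteq\mathrm{cp}_L(C)$. Consequently, $\mathrm{cp}_{\mathrm{units}(C)+L}(C)=\mathrm{cp}_L(C)$.
   Context: A cone in $\mathbb{Q}[X]$ is a subset containing $0$ closed under addition and multiplication by non-negative rationals; $\mathrm{units}(C)=\{p:p\in C,-p\in C\}$. A set $D$ is closed under cutting planes with respect to $L$ if for all $a,b\in\mathbb{Z}$ with $a>0$ and all $p\in L$, $ap+b\in D$ implies $p+\lfloor b/a\rfloor\in D$. $\mathrm{cp}_L(C)$, the cutting plane closure of $C$ w.r.t. $L$, is the least cone that contains $C$ and is closed under cutting planes with respect to $L$. -}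

module Defs where

open import Data.Nat using (ℕ; suc)
open import Data.Integer as ℤ using (ℤ; +_; +[1+_]; -[1+_])
open import Data.Rational as ℚ using (ℚ; 0ℚ; 1ℚ; _≤_)
open import Data.Product using (Σ; ∃; _×_; _,_)
open import Data.Empty using (⊥)
open import Relation.Binary.PropositionalEquality using (_≡_)

data Poly (X : Set) : Set where
  con  : ℚ → Poly X
  var  : X → Poly X
  _⊕_  : Poly X → Poly X → Poly X
  _⊗_  : Poly X → Poly X → Poly X

infixl 6 _⊕_
infixl 7 _⊗_

-- ℚ[X] is the quotient of Poly X by the least congruence making it a
-- commutative ℚ-algebra (i.e. the free commutative ℚ-algebra on X).
infix 4 _≈_
data _≈_ {X : Set} : Poly X → Poly X → Set where
  refl≈   : ∀ {p} → p ≈ p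
  sym≈    : ∀ {p q} → p ≈ q → q ≈ p
  trans≈  : ∀ {p q r} → p ≈ q → q ≈ r → p ≈ r
  ⊕-cong  : ∀ {p p' q q'} → p ≈ p' → q ≈ q' → p ⊕ q ≈ p' ⊕ q'
  ⊗-cong  : ∀ {p p' q q'} → p ≈ p' → q ≈ q' → p ⊗ q ≈ p' ⊗ q'
  ⊕-assoc : ∀ p q r → (p ⊕ q) ⊕ r ≈ p ⊕ (q ⊕ r)
  ⊕-comm  : ∀ p q → p ⊕ q ≈ q ⊕ p
  ⊕-idʳ   : ∀ p → p ⊕ con 0ℚ ≈ p
  ⊕-invʳ  : ∀ p → p ⊕ con (ℚ.- 1ℚ) ⊗ p ≈ con 0ℚ
  ⊗-assoc : ∀ p q r → (p ⊗ q) ⊗ r ≈ p ⊗ (q ⊗ r)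
  ⊗-comm  : ∀ p q → p ⊗ q ≈ q ⊗ p
  ⊗-idʳ   : ∀ p → p ⊗ con 1ℚ ≈ p
  distribʳ : ∀ p q r → (p ⊕ q) ⊗ r ≈ p ⊗ r ⊕ q ⊗ r
  con-+   : ∀ a b → con (a ℚ.+ b) ≈ con a ⊕ con b
  con-*   : ∀ a b → con (a ℚ.* b) ≈ con a ⊗ con b

-- Subsets of ℚ[X]: predicates on Poly X respecting ≈.
Subset : Set → Set₁
Subset X = Poly X → Set

Respects≈ : ∀ {X} → Subset X → Set
Respects≈ {X} S = ∀ {p q : Poly X} → p ≈ q → S p → S q

_⊆_ : ∀ {X} → Subset X → Subset X → Set
S ⊆ T = ∀ p → S p → T p

ι : ∀ {X} → ℤ → Poly X
ι z = con (z ℚ./ 1)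

IsCone : ∀ {X} → Subset X → Set
IsCone {X} C = Respects≈ C
  × C (con 0ℚ)
  × (∀ p q → C p → C q → C (p ⊕ q))
  × (∀ (c : ℚ) p → 0ℚ ≤ c → C p → C (con c ⊗ p))

units : ∀ {X} → Subset X → Subset X
units C p = C p × C (con (ℚ.- 1ℚ) ⊗ p)

_+ˢ_ : ∀ {X} → Subset X → Subset X → Subset X
(U +ˢ L) p = Σ _ λ u → Σ _ λ l → U u × L l × (p ≈ u ⊕ l)

floorDiv : ℤ → (a : ℤ) → .(ℤ.Positive a) → ℤ
floorDiv b +[1+ n ] _ = ℚ.floor (b ℚ./ suc n)

ClosedCP : ∀ {X} → Subset X → Subset X → Set
ClosedCP {X} L D = ∀ (a b : ℤ) (a>0 : ℤ.Positive a) (p : Poly X) → L p →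
  D (ι a ⊗ p ⊕ ι b) → D (p ⊕ ι (floorDiv b a a>0))

-- cp_L(C): least cone containing C, closed under cutting planes w.r.t. L
-- (inductively generated, hence least).
data cp {X : Set} (L C : Subset X) : Subset X where
  inC   : ∀ {p} → C p → cp L C p
  resp  : ∀ {p q} → p ≈ q → cp L C p → cp L C q
  zero  : cp L C (con 0ℚ)
  add   : ∀ {p q} → cp L C p → cp L C q → cp L C (p ⊕ q)
  scale : ∀ {c p} → 0ℚ ≤ c → cp L C p → cp L C (con c ⊗ p)
  cut   : ∀ (a b : ℤ) (a>0 : ℤ.Positive a) {p} → L p →
          cp L C (ι a ⊗ p ⊕ ι b) → cp L C (p ⊕ ι (floorDiv b a a>0))

{-# OPTIONS --safe #-}
module Submission where

-- A cut on p = u + l with u a unit of a cone D is a cut on l shifted by u: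
-- adding a·(−u) to a·p + b gives a·l + b, cutting yields l + ⌊b/a⌋, and adding
-- u back gives p + ⌊b/a⌋.  So a cone closed under cutting planes w.r.t. L is
-- closed w.r.t. units(D) + L.  Applied to D = cp_L(C), whose units contain
-- units(C), minimality of cp_{L'}(C) gives the inclusions; the reverse one holds
-- because 0 ∈ units(C), so L ⊆ units(C) + L.

open import Defs
open import Data.Product using (_×_; _,_)
open import Data.Integer as ℤ using (ℤ; +[1+_])
open import Data.Rational as ℚ using (0ℚ; 1ℚ)
open import Data.Rational.Properties using (nonNegative⁻¹; normalize-nonNeg)
open import Data.Nat using (suc)

private
  variable
    X : Set

ι-nonNeg : (a : ℤ) → ℤ.Positive a → 0ℚ ℚ.≤ (a ℚ./ 1)
ι-nonNeg +[1+ n ] _ = nonNegative⁻¹ _ {{normalize-nonNeg (suc n) 1}}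

⊗-⊕-distribˡ : (a p q : Poly X) → a ⊗ (p ⊕ q) ≈ a ⊗ p ⊕ a ⊗ q
⊗-⊕-distribˡ a p q =
  trans≈ (⊗-comm a _) (trans≈ (distribʳ p q a) (⊕-cong (⊗-comm p a) (⊗-comm q a)))

⊗-neg-comm : (a u : Poly X) → a ⊗ (con (ℚ.- 1ℚ) ⊗ u) ≈ con (ℚ.- 1ℚ) ⊗ (a ⊗ u)
⊗-neg-comm a u = trans≈ (sym≈ (⊗-assoc a _ u))
  (trans≈ (⊗-cong (⊗-comm a _) refl≈) (⊗-assoc _ a u))

⊕-cancelˡ : (x y n : Poly X) → x ⊕ n ≈ con 0ℚ → (x ⊕ y) ⊕ n ≈ y
⊕-cancelˡ x y n x+n≈0 =
  trans≈ (⊕-comm _ n)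
  (trans≈ (sym≈ (⊕-assoc n x y))
  (trans≈ (⊕-cong (trans≈ (⊕-comm n x) x+n≈0) refl≈)
  (trans≈ (⊕-comm _ y) (⊕-idʳ y))))

scaled-sum-minus-unit : (a u l b : Poly X) →
  (a ⊗ (u ⊕ l) ⊕ b) ⊕ a ⊗ (con (ℚ.- 1ℚ) ⊗ u) ≈ a ⊗ l ⊕ b
scaled-sum-minus-unit a u l b =
  trans≈ (⊕-cong (trans≈ (⊕-cong (⊗-⊕-distribˡ a u l) refl≈) (⊕-assoc _ _ _)) refl≈)
    (⊕-cancelˡ (a ⊗ u) (a ⊗ l ⊕ b) _
      (trans≈ (⊕-cong refl≈ (⊗-neg-comm a u)) (⊕-invʳ (a ⊗ u))))

units-zero : {D : Subset X} → IsCone D → units D (con 0ℚ)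
units-zero (resp-D , zero-D , _) = zero-D , resp-D (con-* (ℚ.- 1ℚ) 0ℚ) zero-D

⊆-units+ˢ : {D : Subset X} → IsCone D → (L : Subset X) → L ⊆ (units D +ˢ L)
⊆-units+ˢ cone L l l∈L = con 0ℚ , l , units-zero cone , l∈L , sym≈ (trans≈ (⊕-comm _ l) (⊕-idʳ l))

closedCP-units+ˢ : {D L : Subset X} → IsCone D → ClosedCP L D → ClosedCP (units D +ˢ L) D
closedCP-units+ˢ {D = D} (resp-D , _ , add-D , scale-D) closed
  a b a>0 p (u , l , (u∈D , −u∈D) , l∈L , p≈u+l) ap+b∈D =
  resp-D u+[l+f]≈p+f (add-D _ _ u∈D l+f∈D)
  where
    f : Poly _
    f = ι (floorDiv b a a>0)
    al+b∈D : D (ι a ⊗ l ⊕ ι b)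
    al+b∈D = resp-D
      (trans≈ (⊕-cong (⊕-cong (⊗-cong refl≈ p≈u+l) refl≈) refl≈)
              (scaled-sum-minus-unit (ι a) u l (ι b)))
      (add-D _ _ ap+b∈D (scale-D _ _ (ι-nonNeg a a>0) −u∈D))
    l+f∈D : D (l ⊕ f)
    l+f∈D = closed a b a>0 l l∈L al+b∈D
    u+[l+f]≈p+f : u ⊕ (l ⊕ f) ≈ p ⊕ f
    u+[l+f]≈p+f = trans≈ (sym≈ (⊕-assoc u l f)) (⊕-cong (sym≈ p≈u+l) refl≈)

units-mono : {C D : Subset X} → C ⊆ D → units C ⊆ units D
units-mono C⊆D p (p∈C , −p∈C) = C⊆D _ p∈C , C⊆D _ −p∈C

+ˢ-monoˡ : {U V L : Subset X} → U ⊆ V → (U +ˢ L) ⊆ (V +ˢ L)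
+ˢ-monoˡ U⊆V p (u , l , u∈U , l∈L , p≈u+l) = u , l , U⊆V u u∈U , l∈L , p≈u+l

closedCP-antitone : {L L' D : Subset X} → L' ⊆ L → ClosedCP L D → ClosedCP L' D
closedCP-antitone L'⊆L closed a b a>0 p p∈L' = closed a b a>0 p (L'⊆L p p∈L')

module _ {L C : Subset X} where

  cp-isCone : IsCone (cp L C)
  cp-isCone = resp , zero , (λ _ _ → add) , (λ _ _ → scale)

  cp-closedCP : ClosedCP L (cp L C)
  cp-closedCP a b a>0 _ = cut a b a>0

  cp-least : (D : Subset X) → IsCone D → C ⊆ D → ClosedCP L D → cp L C ⊆ D
  cp-least D (resp-D , zero-D , add-D , scale-D) C⊆D closed = go
    where
      go : cp L C ⊆ D
      go p (inC p∈C)           = C⊆D p p∈C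
      go _ (resp e d)          = resp-D e (go _ d)
      go _ zero                = zero-D
      go _ (add d e)           = add-D _ _ (go _ d) (go _ e)
      go _ (scale 0≤c d)       = scale-D _ _ 0≤c (go _ d)
      go _ (cut a b a>0 p∈L d) = closed a b a>0 _ p∈L (go _ d)

  C⊆cp : C ⊆ cp L C
  C⊆cp _ = inC

cp-units+ˢ-⊆ : {C L L' : Subset X} → L' ⊆ (units C +ˢ L) → cp L' C ⊆ cp L C
cp-units+ˢ-⊆ {C = C} {L} {L'} L'⊆U+L =
  cp-least _ cp-isCone C⊆cp
    (closedCP-antitone {D = cp L C} L'⊆U'+L (closedCP-units+ˢ cp-isCone cp-closedCP))
  where
    L'⊆U'+L : L' ⊆ (units (cp L C) +ˢ L)
    L'⊆U'+L p p∈L' = +ˢ-monoˡ (units-mono C⊆cp) p (L'⊆U+L p p∈L')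

lemma4p5 : {X : Set} (C L L' : Subset X) → IsCone C → Respects≈ L → Respects≈ L' →
    L' ⊆ (units C +ˢ L) →
    (cp L' C ⊆ cp L C) × (cp (units C +ˢ L) C ⊆ cp L C) × (cp L C ⊆ cp (units C +ˢ L) C)
lemma4p5 C L L' cone _ _ L'⊆U+L =
  cp-units+ˢ-⊆ L'⊆U+L ,
  cp-units+ˢ-⊆ (λ _ p → p) ,
  cp-least _ cp-isCone C⊆cp (closedCP-antitone {D = cp _ C} (⊆-units+ˢ cone L) cp-closedCP)
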